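{- Let $q$ be a prime power and let $i,d,k,n$ be integers with $3\leq i\leq d<k$ and $2k\leq n$. Define $[x]_{m}=\prod_{j=0}^{m-1}(q^{x-j}-1)$, $$S_i(n)=\frac{q^{\binom{i}{2}-ki+k}[k-1]_{i-1}}{[n-k-1]_{i-1}},\qquad T_i(n)=\frac{q^{(k-2d)(i-1)+\binom{i}{2}}[d-1]_{i-1}^{2}[n-k-1]_{i-1}}{[k-1]_{i-1}[n-d-1]_{i-1}^{2}}.$$ Then $(q^{k}-1)S_i(n)-(q^{d}-1)T_i(n)<q^{k}-q^{d}$. -}

module Defs where

open import Data.Nat as ℕ using (ℕ; zero; suc; _∸_)
open import Data.Nat.Primality using (Prime)
open import Data.Integer as ℤ using (ℤ; +_; -[1+_])
open import Data.Rational using (ℚ; 0ℚ; 1ℚ; _+_; _*_; _-_; _≟_; 1/_; ≢-nonZero)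
open import Data.Product using (Σ; _×_)
open import Relation.Nullary using (yes; no)

IsPrimePower : ℕ → Set
IsPrimePower q = Σ ℕ λ p → Σ ℕ λ e → Prime p × (1 ℕ.≤ e) × (q ≡ p ℕ.^ e)
  where open import Relation.Binary.PropositionalEquality using (_≡_)

ℚof : ℕ → ℚ
ℚof n = Data.Rational._/_ (+ n) 1

-- total reciprocal (0 ↦ 0); only applied to nonzero values in the statement
inv : ℚ → ℚ
inv p with p ≟ 0ℚ
... | yes _ = 0ℚ
... | no p≢0 = 1/_ p {{≢-nonZero p≢0}}

_÷'_ : ℚ → ℚ → ℚ
p ÷' r = p * inv r
infixl 7 _÷'_

_^ℕ_ : ℚ → ℕ → ℚ
p ^ℕ zero = 1ℚ
p ^ℕ suc m = p * (p ^ℕ m)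

_^ℤ_ : ℚ → ℤ → ℚ
p ^ℤ (+ m) = p ^ℕ m
p ^ℤ -[1+ m ] = inv (p ^ℕ suc m)

-- [x]_m = ∏_{j=0}^{m-1} (q^{x-j} - 1)   (x - j ≥ 0 wherever used)
bracket : ℕ → ℕ → ℕ → ℚ
bracket q x zero = 1ℚ
bracket q x (suc m) = bracket q x m * ((ℚof q ^ℕ (x ∸ m)) - 1ℚ)

binom2 : ℕ → ℤ
binom2 i = + (i ℕ.* (i ∸ 1) ℕ./ 2)

S : ℕ → ℕ → ℕ → ℕ → ℚ
S q k i n =
  ((ℚof q ^ℤ (binom2 i ℤ.- (+ k) ℤ.* (+ i) ℤ.+ (+ k))) * bracket q (k ∸ 1) (i ∸ 1))
  ÷' bracket q (n ∸ k ∸ 1) (i ∸ 1)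

T : ℕ → ℕ → ℕ → ℕ → ℕ → ℚ
T q k d i n =
  ((ℚof q ^ℤ (((+ k) ℤ.- (+ (2 ℕ.* d))) ℤ.* (+ (i ∸ 1)) ℤ.+ binom2 i))
     * (bracket q (d ∸ 1) (i ∸ 1) * bracket q (d ∸ 1) (i ∸ 1))
     * bracket q (n ∸ k ∸ 1) (i ∸ 1))
  ÷' (bracket q (k ∸ 1) (i ∸ 1)
       * (bracket q (n ∸ d ∸ 1) (i ∸ 1) * bracket q (n ∸ d ∸ 1) (i ∸ 1)))

-- Every bracket factor q^(x-j) - 1 is nonnegative, so T ≥ 0 and the left-hand side is at
-- most (q^k - 1) S.  In S the quotient of brackets is at most 1, since brackets grow with x
-- and k - 1 ≤ n - k - 1, while for 3 ≤ i < k the exponent binom(i,2) - ki + k is at most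
-- -(k+1).  Hence (q^k - 1) S < q^k q^-(k+1) < 1 ≤ q^k - q^d.

module Submission where

open import Defs
open import Data.Nat using (ℕ; _≤_; _<_; _*_)
open import Data.Rational using (ℚ; 1ℚ) renaming (_<_ to _<ℚ_; _-_ to _-ℚ_; _*_ to _*ℚ_)

open import Data.Nat using (zero; suc; _+_; _∸_; _/_; s≤s)
import Data.Nat.Properties as ℕₚ
open import Data.Nat.Base using (nonTrivial⇒n>1)
open import Data.Nat.DivMod using (m/n*n≤m)
open import Data.Nat.Primality using (prime⇒nonTrivial)
import Data.Nat.Coprimality as Coprime
open import Data.Nat.Tactic.RingSolver using (solve-∀)
open import Data.Integer as ℤ using (ℤ; +_; -[1+_])
import Data.Integer.Properties as ℤₚ
import Data.Integer.Tactic.RingSolver as ℤ-Solver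
open import Data.Rational
  using (0ℚ; mkℚ; -_; *≤*; *<*; _≟_; ≢-nonZero; positive; nonNegative)
  renaming (_+_ to _+ℚ_; _≤_ to _≤ℚ_)
import Data.Rational.Properties as ℚₚ
open import Data.Product using (∃-syntax; _×_; _,_)
open import Relation.Binary.Definitions using (tri<; tri≈; tri>)
open import Relation.Binary.PropositionalEquality
  using (_≡_; refl; sym; trans; cong; cong₂; subst; subst₂; module ≡-Reasoning)
open import Relation.Nullary using (yes; no; contradiction)

i[i∸1]+[2k+1]*2≤ki*2 : ∀ {i k} → 3 ≤ i → i < k → i * (i ∸ 1) + (k + suc k) * 2 ≤ k * i * 2
i[i∸1]+[2k+1]*2≤ki*2 3≤i i<k
  with a , refl ← ℕₚ.m≤n⇒∃[o]m+o≡n 3≤i | b , refl ← ℕₚ.m≤n⇒∃[o]m+o≡n i<k =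
  ℕₚ.≤-trans (ℕₚ.m≤m+n _ _) (ℕₚ.≤-reflexive (expand a b))
  where
  expand : ∀ a b → let i = 3 + a; k = 4 + a + b in
    i * (2 + a) + (k + suc k) * 2 + (5 * a + a * a + 2 * b + 2 * a * b) ≡ k * i * 2
  expand = solve-∀

binom2-gap : ∀ {i k} → 3 ≤ i → i < k → i * (i ∸ 1) / 2 + (k + suc k) ≤ k * i
binom2-gap {i} {k} 3≤i i<k = ℕₚ.*-cancelʳ-≤ _ _ 2 (begin
  (h + (k + suc k)) * 2          ≡⟨ ℕₚ.*-distribʳ-+ 2 h (k + suc k) ⟩
  h * 2 + (k + suc k) * 2        ≤⟨ ℕₚ.+-monoˡ-≤ ((k + suc k) * 2) (m/n*n≤m (i * (i ∸ 1)) 2) ⟩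
  i * (i ∸ 1) + (k + suc k) * 2  ≤⟨ i[i∸1]+[2k+1]*2≤ki*2 3≤i i<k ⟩
  k * i * 2                      ∎)
  where
  open ℕₚ.≤-Reasoning
  h = i * (i ∸ 1) / 2

a-[a+c+1+m]+c≡-[1+m] : ∀ a c m → + a ℤ.- + (a + c + suc m) ℤ.+ + c ≡ -[1+ m ]
a-[a+c+1+m]+c≡-[1+m] a c m = begin
  + a ℤ.- + (a + c + suc m) ℤ.+ + c            ≡⟨ cong (λ z → + a ℤ.- z ℤ.+ + c) pos-sum ⟩
  + a ℤ.- (+ a ℤ.+ + c ℤ.+ + suc m) ℤ.+ + c    ≡⟨ cancel (+ a) (+ c) (+ suc m) ⟩
  ℤ.- + suc m                                  ∎
  where
  open ≡-Reasoning
  pos-sum : + (a + c + suc m) ≡ + a ℤ.+ + c ℤ.+ + suc m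
  pos-sum = trans (ℤₚ.pos-+ (a + c) (suc m)) (cong (ℤ._+ + suc m) (ℤₚ.pos-+ a c))
  cancel : ∀ x y z → x ℤ.- (x ℤ.+ y ℤ.+ z) ℤ.+ y ≡ ℤ.- z
  cancel = ℤ-Solver.solve-∀

S-exponent : ∀ {i k} → 3 ≤ i → i < k →
  ∃[ m ] k ≤ m × binom2 i ℤ.- + k ℤ.* + i ℤ.+ + k ≡ -[1+ m ]
S-exponent {i} {k} 3≤i i<k with o , gap ← ℕₚ.m≤n⇒∃[o]m+o≡n (binom2-gap 3≤i i<k) =
  k + o , ℕₚ.m≤m+n k o , (begin
    + h ℤ.- + k ℤ.* + i ℤ.+ + k                  ≡⟨ cong (λ z → + h ℤ.- z ℤ.+ + k) (ℤₚ.pos-* k i) ⟨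
    + h ℤ.- + (k * i) ℤ.+ + k                    ≡⟨ cong (λ z → + h ℤ.- + z ℤ.+ + k) ki≡ ⟩
    + h ℤ.- + (h + k + suc (k + o)) ℤ.+ + k      ≡⟨ a-[a+c+1+m]+c≡-[1+m] h k (k + o) ⟩
    -[1+ k + o ]                                 ∎)
  where
  open ≡-Reasoning
  h = i * (i ∸ 1) / 2
  regroup : ∀ h k o → h + (k + suc k) + o ≡ h + k + suc (k + o)
  regroup = solve-∀
  ki≡ : k * i ≡ h + k + suc (k + o)
  ki≡ = trans (sym gap) (regroup h k o)

p<q⇒0<q-p : ∀ {p q} → p <ℚ q → 0ℚ <ℚ q -ℚ p
p<q⇒0<q-p {p} {q} p<q = subst (_<ℚ q -ℚ p) (ℚₚ.+-inverseʳ p) (ℚₚ.+-monoˡ-< (- p) p<q)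

p≤q⇒0≤q-p : ∀ {p q} → p ≤ℚ q → 0ℚ ≤ℚ q -ℚ p
p≤q⇒0≤q-p {p} {q} p≤q = subst (_≤ℚ q -ℚ p) (ℚₚ.+-inverseʳ p) (ℚₚ.+-monoˡ-≤ (- p) p≤q)

p+r≤q⇒p≤q-r : ∀ {p q r} → p +ℚ r ≤ℚ q → p ≤ℚ q -ℚ r
p+r≤q⇒p≤q-r {p} {q} {r} p+r≤q = subst (_≤ℚ q -ℚ r) p+r-r≡p (ℚₚ.+-monoˡ-≤ (- r) p+r≤q)
  where
  open ≡-Reasoning
  p+r-r≡p : p +ℚ r -ℚ r ≡ p
  p+r-r≡p = begin
    p +ℚ r -ℚ r      ≡⟨ ℚₚ.+-assoc p r (- r) ⟩
    p +ℚ (r -ℚ r)    ≡⟨ cong (p +ℚ_) (ℚₚ.+-inverseʳ r) ⟩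
    p +ℚ 0ℚ          ≡⟨ ℚₚ.+-identityʳ p ⟩
    p                ∎

p-q≤p : ∀ p {q} → 0ℚ ≤ℚ q → p -ℚ q ≤ℚ p
p-q≤p p 0≤q = subst (p -ℚ _ ≤ℚ_) (ℚₚ.+-identityʳ p) (ℚₚ.+-monoʳ-≤ p (ℚₚ.neg-antimono-≤ 0≤q))

p-q<p : ∀ p {q} → 0ℚ <ℚ q → p -ℚ q <ℚ p
p-q<p p 0<q = subst (p -ℚ _ <ℚ_) (ℚₚ.+-identityʳ p) (ℚₚ.+-monoʳ-< p (ℚₚ.neg-antimono-< 0<q))

*-nonNeg : ∀ {p q} → 0ℚ ≤ℚ p → 0ℚ ≤ℚ q → 0ℚ ≤ℚ p *ℚ q
*-nonNeg {p} {q} 0≤p 0≤q =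
  ℚₚ.nonNegative⁻¹ _ {{ℚₚ.nonNeg*nonNeg⇒nonNeg p {{nonNegative 0≤p}} q {{nonNegative 0≤q}}}}

*-pos : ∀ {p q} → 0ℚ <ℚ p → 0ℚ <ℚ q → 0ℚ <ℚ p *ℚ q
*-pos {p} {q} 0<p 0<q = ℚₚ.positive⁻¹ _ {{ℚₚ.pos*pos⇒pos p {{positive 0<p}} q {{positive 0<q}}}}

*-mono-≤-nonNeg : ∀ {p p′ q q′} → 0ℚ ≤ℚ p′ → 0ℚ ≤ℚ q → p ≤ℚ p′ → q ≤ℚ q′ → p *ℚ q ≤ℚ p′ *ℚ q′
*-mono-≤-nonNeg {p′ = p′} {q} 0≤p′ 0≤q p≤p′ q≤q′ = ℚₚ.≤-trans
  (ℚₚ.*-monoʳ-≤-nonNeg q {{nonNegative 0≤q}} p≤p′)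
  (ℚₚ.*-monoˡ-≤-nonNeg p′ {{nonNegative 0≤p′}} q≤q′)

inv-pos : ∀ {p} → 0ℚ <ℚ p → 0ℚ <ℚ inv p
inv-pos {p} 0<p with p ≟ 0ℚ
... | yes refl = contradiction 0<p (ℚₚ.<-irrefl refl)
... | no _     = ℚₚ.positive⁻¹ _ {{ℚₚ.1/pos⇒pos p {{positive 0<p}}}}

inv-nonNeg : ∀ {p} → 0ℚ ≤ℚ p → 0ℚ ≤ℚ inv p
inv-nonNeg {p} 0≤p with ℚₚ.<-cmp 0ℚ p
... | tri< 0<p _ _ = ℚₚ.<⇒≤ (inv-pos 0<p)
... | tri≈ _ refl _ = ℚₚ.≤-refl
... | tri> _ _ p<0 = contradiction (ℚₚ.<-≤-trans p<0 0≤p) (ℚₚ.<-irrefl refl)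

*-inv : ∀ {p} → 0ℚ <ℚ p → p *ℚ inv p ≡ 1ℚ
*-inv {p} 0<p with p ≟ 0ℚ
... | yes refl = contradiction 0<p (ℚₚ.<-irrefl refl)
... | no p≢0   = ℚₚ.*-inverseʳ p {{≢-nonZero p≢0}}

p*r÷'s≤p : ∀ {p r s} → 0ℚ ≤ℚ p → 0ℚ <ℚ r → r ≤ℚ s → p *ℚ r ÷' s ≤ℚ p
p*r÷'s≤p {p} {r} {s} 0≤p 0<r r≤s = begin
  p *ℚ r *ℚ inv s     ≤⟨ ℚₚ.*-monoʳ-≤-nonNeg (inv s) {{nonNegative (ℚₚ.<⇒≤ (inv-pos 0<s))}}
                           (ℚₚ.*-monoˡ-≤-nonNeg p {{nonNegative 0≤p}} r≤s) ⟩
  p *ℚ s *ℚ inv s     ≡⟨ ℚₚ.*-assoc p s (inv s) ⟩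
  p *ℚ (s *ℚ inv s)   ≡⟨ cong (p *ℚ_) (*-inv 0<s) ⟩
  p *ℚ 1ℚ             ≡⟨ ℚₚ.*-identityʳ p ⟩
  p                   ∎
  where
  open ℚₚ.≤-Reasoning
  0<s = ℚₚ.<-≤-trans 0<r r≤s

module Powers {X : ℚ} (1≤X : 1ℚ ≤ℚ X) where

  0≤X : 0ℚ ≤ℚ X
  0≤X = ℚₚ.≤-trans (ℚₚ.nonNegative⁻¹ 1ℚ) 1≤X

  1≤^ℕ : ∀ t → 1ℚ ≤ℚ X ^ℕ t
  1≤^ℕ zero    = ℚₚ.≤-refl
  1≤^ℕ (suc t) = *-mono-≤-nonNeg 0≤X (ℚₚ.nonNegative⁻¹ 1ℚ) 1≤X (1≤^ℕ t)

  ^ℕ-pos : ∀ t → 0ℚ <ℚ X ^ℕ t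
  ^ℕ-pos t = ℚₚ.<-≤-trans (ℚₚ.positive⁻¹ 1ℚ) (1≤^ℕ t)

  ^ℕ-nonNeg : ∀ t → 0ℚ ≤ℚ X ^ℕ t
  ^ℕ-nonNeg t = ℚₚ.<⇒≤ (^ℕ-pos t)

  ^ℤ-nonNeg : ∀ z → 0ℚ ≤ℚ X ^ℤ z
  ^ℤ-nonNeg (+ t)     = ^ℕ-nonNeg t
  ^ℤ-nonNeg -[1+ t ] = inv-nonNeg (^ℕ-nonNeg (suc t))

  ^ℕ-1-nonNeg : ∀ t → 0ℚ ≤ℚ X ^ℕ t -ℚ 1ℚ
  ^ℕ-1-nonNeg t = p≤q⇒0≤q-p (1≤^ℕ t)

  ^ℕ-monoʳ-≤ : ∀ {s t} → s ≤ t → X ^ℕ s ≤ℚ X ^ℕ t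
  ^ℕ-monoʳ-≤ {zero}  {t}     _         = 1≤^ℕ t
  ^ℕ-monoʳ-≤ {suc s} {suc t} (s≤s s≤t) = ℚₚ.*-monoˡ-≤-nonNeg X {{nonNegative 0≤X}} (^ℕ-monoʳ-≤ s≤t)

  ^ℕ-1-pos : 1ℚ <ℚ X → ∀ {t} → 1 ≤ t → 0ℚ <ℚ X ^ℕ t -ℚ 1ℚ
  ^ℕ-1-pos 1<X {t} 1≤t =
    p<q⇒0<q-p (ℚₚ.<-≤-trans 1<X (subst (_≤ℚ X ^ℕ t) (ℚₚ.*-identityʳ X) (^ℕ-monoʳ-≤ 1≤t)))

  1+^ℕ≤^ℕ-suc : ℚof 2 ≤ℚ X → ∀ t → 1ℚ +ℚ X ^ℕ t ≤ℚ X ^ℕ suc t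
  1+^ℕ≤^ℕ-suc 2≤X t = begin
    1ℚ +ℚ X ^ℕ t              ≤⟨ ℚₚ.+-monoˡ-≤ (X ^ℕ t) (1≤^ℕ t) ⟩
    X ^ℕ t +ℚ X ^ℕ t          ≡⟨ double ⟨
    (1ℚ +ℚ 1ℚ) *ℚ X ^ℕ t      ≤⟨ ℚₚ.*-monoʳ-≤-nonNeg (X ^ℕ t) {{nonNegative (^ℕ-nonNeg t)}} 2≤X ⟩
    X *ℚ X ^ℕ t               ∎
    where
    open ℚₚ.≤-Reasoning
    double : (1ℚ +ℚ 1ℚ) *ℚ X ^ℕ t ≡ X ^ℕ t +ℚ X ^ℕ t
    double = trans (ℚₚ.*-distribʳ-+ (X ^ℕ t) 1ℚ 1ℚ)
      (cong₂ _+ℚ_ (ℚₚ.*-identityˡ (X ^ℕ t)) (ℚₚ.*-identityˡ (X ^ℕ t)))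

  1≤^ℕ-^ℕ : ℚof 2 ≤ℚ X → ∀ {s t} → s < t → 1ℚ ≤ℚ X ^ℕ t -ℚ X ^ℕ s
  1≤^ℕ-^ℕ 2≤X {s} s<t = p+r≤q⇒p≤q-r (ℚₚ.≤-trans (1+^ℕ≤^ℕ-suc 2≤X s) (^ℕ-monoʳ-≤ s<t))

ℚof≡mkℚ : ∀ n → ℚof n ≡ mkℚ (+ n) 0 (Coprime.sym (Coprime.1-coprimeTo n))
ℚof≡mkℚ n = ℚₚ.normalize-coprime (Coprime.sym (Coprime.1-coprimeTo n))

ℚof-mono-≤ : ∀ {m n} → m ≤ n → ℚof m ≤ℚ ℚof n
ℚof-mono-≤ {m} {n} m≤n rewrite ℚof≡mkℚ m | ℚof≡mkℚ n =
  *≤* (subst₂ ℤ._≤_ (sym (ℤₚ.*-identityʳ (+ m))) (sym (ℤₚ.*-identityʳ (+ n))) (ℤ.+≤+ m≤n))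

ℚof-mono-< : ∀ {m n} → m < n → ℚof m <ℚ ℚof n
ℚof-mono-< {m} {n} m<n rewrite ℚof≡mkℚ m | ℚof≡mkℚ n =
  *<* (subst₂ ℤ._<_ (sym (ℤₚ.*-identityʳ (+ m))) (sym (ℤₚ.*-identityʳ (+ n))) (ℤ.+<+ m<n))

module _ {q : ℕ} (1≤q : 1 ≤ q) where
  open Powers (ℚof-mono-≤ 1≤q)

  bracket-nonNeg : ∀ x m → 0ℚ ≤ℚ bracket q x m
  bracket-nonNeg x zero    = ℚₚ.nonNegative⁻¹ 1ℚ
  bracket-nonNeg x (suc m) = *-nonNeg (bracket-nonNeg x m) (^ℕ-1-nonNeg (x ∸ m))

  bracket-monoˡ-≤ : ∀ {x y} m → x ≤ y → bracket q x m ≤ℚ bracket q y m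
  bracket-monoˡ-≤ zero    _   = ℚₚ.≤-refl
  bracket-monoˡ-≤ {x} {y} (suc m) x≤y = *-mono-≤-nonNeg (bracket-nonNeg y m) (^ℕ-1-nonNeg (x ∸ m))
    (bracket-monoˡ-≤ m x≤y) (ℚₚ.+-monoˡ-≤ (- 1ℚ) (^ℕ-monoʳ-≤ (ℕₚ.∸-monoˡ-≤ m x≤y)))

  T-nonNeg : ∀ k d i n → 0ℚ ≤ℚ T q k d i n
  T-nonNeg k d i n =
    *-nonNeg (*-nonNeg (*-nonNeg (^ℤ-nonNeg e) (*-nonNeg (br (d ∸ 1)) (br (d ∸ 1))))
                       (br (n ∸ k ∸ 1)))
      (inv-nonNeg (*-nonNeg (br (k ∸ 1)) (*-nonNeg (br (n ∸ d ∸ 1)) (br (n ∸ d ∸ 1)))))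
    where
    e = (+ k ℤ.- + (2 * d)) ℤ.* + (i ∸ 1) ℤ.+ binom2 i
    br : ∀ x → 0ℚ ≤ℚ bracket q x (i ∸ 1)
    br x = bracket-nonNeg x (i ∸ 1)

bracket-pos : ∀ {q} → 1 < q → ∀ {x} m → m ≤ x → 0ℚ <ℚ bracket q x m
bracket-pos 1<q zero    _   = ℚₚ.positive⁻¹ 1ℚ
bracket-pos 1<q (suc m) m<x =
  *-pos (bracket-pos 1<q m (ℕₚ.<⇒≤ m<x)) (^ℕ-1-pos (ℚof-mono-< 1<q) (ℕₚ.m<n⇒0<n∸m m<x))
  where open Powers (ℚof-mono-≤ (ℕₚ.<⇒≤ 1<q))

S-small : ∀ {q i k n} → 1 < q → 3 ≤ i → i < k → k ≤ n ∸ k →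
  (ℚof q ^ℕ k -ℚ 1ℚ) *ℚ S q k i n <ℚ 1ℚ
S-small {q} {i} {k} {n} 1<q 3≤i i<k k≤n∸k
  with m , k≤m , exponent≡ ← S-exponent 3≤i i<k = begin-strict
  (X ^ℕ k -ℚ 1ℚ) *ℚ S q k i n  ≤⟨ ℚₚ.*-monoˡ-≤-nonNeg (X ^ℕ k -ℚ 1ℚ) {{0≤X^k-1}} S≤ ⟩
  (X ^ℕ k -ℚ 1ℚ) *ℚ inv Y      <⟨ ℚₚ.*-monoˡ-<-pos (inv Y) {{0<Y⁻¹}} X^k-1<Y ⟩
  Y *ℚ inv Y                   ≡⟨ *-inv (^ℕ-pos (suc m)) ⟩
  1ℚ                           ∎
  where
  open ℚₚ.≤-Reasoning
  1≤q = ℕₚ.<⇒≤ 1<q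
  open Powers (ℚof-mono-≤ 1≤q)
  X = ℚof q
  Y = X ^ℕ suc m
  0≤X^k-1 = nonNegative (^ℕ-1-nonNeg k)
  0<Y⁻¹ = positive (inv-pos (^ℕ-pos (suc m)))
  S≤ : S q k i n ≤ℚ inv Y
  S≤ = subst (S q k i n ≤ℚ_) (cong (X ^ℤ_) exponent≡) (p*r÷'s≤p
    (^ℤ-nonNeg (binom2 i ℤ.- + k ℤ.* + i ℤ.+ + k))
    (bracket-pos 1<q (i ∸ 1) (ℕₚ.∸-monoˡ-≤ 1 (ℕₚ.<⇒≤ i<k)))
    (bracket-monoˡ-≤ 1≤q (i ∸ 1) (ℕₚ.∸-monoˡ-≤ 1 k≤n∸k)))
  X^k-1<Y : X ^ℕ k -ℚ 1ℚ <ℚ Y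
  X^k-1<Y = ℚₚ.<-≤-trans (p-q<p (X ^ℕ k) (ℚₚ.positive⁻¹ 1ℚ)) (^ℕ-monoʳ-≤ (ℕₚ.m≤n⇒m≤1+n k≤m))

primePower⇒1< : ∀ {q} → IsPrimePower q → 1 < q
primePower⇒1< (p , e , p-prime , 1≤e , refl) =
  ℕₚ.^-monoʳ-< p (nonTrivial⇒n>1 p {{prime⇒nonTrivial p-prime}}) 1≤e

lemmaA4 : (q i d k n : ℕ) → IsPrimePower q → 3 ≤ i → i ≤ d → d < k → 2 * k ≤ n →
    ((ℚof q ^ℕ k) -ℚ 1ℚ) *ℚ S q k i n -ℚ ((ℚof q ^ℕ d) -ℚ 1ℚ) *ℚ T q k d i n
      <ℚ (ℚof q ^ℕ k) -ℚ (ℚof q ^ℕ d)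
lemmaA4 q i d k n q-primePower 3≤i i≤d d<k 2k≤n = begin-strict
  (X ^ℕ k -ℚ 1ℚ) *ℚ S q k i n -ℚ (X ^ℕ d -ℚ 1ℚ) *ℚ T q k d i n
    ≤⟨ p-q≤p _ (*-nonNeg (^ℕ-1-nonNeg d) (T-nonNeg 1≤q k d i n)) ⟩
  (X ^ℕ k -ℚ 1ℚ) *ℚ S q k i n
    <⟨ S-small 1<q 3≤i (ℕₚ.≤-<-trans i≤d d<k) k≤n∸k ⟩
  1ℚ
    ≤⟨ 1≤^ℕ-^ℕ (ℚof-mono-≤ 1<q) d<k ⟩
  X ^ℕ k -ℚ X ^ℕ d ∎
  where
  open ℚₚ.≤-Reasoning
  X = ℚof q
  1<q = primePower⇒1< q-primePower
  1≤q = ℕₚ.<⇒≤ 1<q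
  open Powers (ℚof-mono-≤ 1≤q)
  k≤n∸k : k ≤ n ∸ k
  k≤n∸k = ℕₚ.m+n≤o⇒m≤o∸n k (subst (λ j → k + j ≤ n) (ℕₚ.+-identityʳ k) 2k≤n)
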